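{- Let $R$, $\mathcal T$, $\ell$, $a$, $d$ and $r_{i,j}$ be as in the context. Let $n>s$ and $0\le i\le n$ be integers, let $v$ be a node of $\mathcal T$ with $\ell(v)=n$, and let $w$ be the node in the same row as $v$ with $\ell(w)=n-i$. Then $r_{d(n-i),i}=1$ if and only if $w$ is the left-most child of the parent of $v$.
   Context: Let $R=\langle s,r_1,r_2,\ldots\rangle$ be a sequence of nonnegative integers with $s\ge 1$, and set $r_0=-1$. For integers $i,j\ge 0$ let $r_{i,j}=1$ if $r_i\ge j$ and $r_{i,j}=0$ otherwise. Let $\Sigma=\{\mathtt r,\mathtt 0,\mathtt 1,\mathtt 2,\ldots\}$ be the infinite alphabet consisting of a letter $\mathtt r$ together with a letter $[j]$ for each integer $j\ge 0$. For a letter $\mathtt x$ and $m\ge0$, $\mathtt x^m$ is the word of $m$ copies of $\mathtt x$. Let $\sigma$ be the morphism of words over $\Sigma$ defined by $\sigma(\mathtt r)=\mathtt r\,\mathtt 0^{s}$ and $\sigma([j])=[j+1]\,\mathtt 0^{r_{j+1}}$ for $j\ge 0$. Let $\mathcal T$ be the infinite rooted ordered tree whose root is labelled $\mathtt r$ and in which the labels of the children of any node labelled $\mathtt x$, read left to right, spell $\sigma(\mathtt x)$. For a node $v$, $\ell(v)$ is the number of nodes in the same row (depth) as $v$ lying strictly to its left. Define $a:\mathbb Z\to\mathbb Z_{\ge0}$ by $a(n)=0$ for $n<0$ and $a(\ell(v))=\ell(\mathrm{parent}(v))$ for every non-root node $v$ of $\mathcal T$ (this is well defined). Let $a^0$ be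 the identity and $a^k$ the $k$-fold composition of $a$. For $n\ge 0$ define $d(n)=\max\{k\ge 0: a^k(n)-a^k(n-1)=1\}$ (this maximum exists; $d(0)=0$). -}

module Defs where

open import Data.Nat using (ℕ; zero; suc; _+_; _∸_; _≤_; _<_; _<ᵇ_)
open import Data.Integer as ℤ using (ℤ; +_; -[1+_]; _-_)
open import Data.Bool using (Bool; true; false; if_then_else_)
open import Data.List using (List; []; _∷_; replicate; concatMap; length; take; map)
open import Data.Nat.ListAction using (sum)
open import Data.Product using (_×_)
open import Relation.Binary.PropositionalEquality using (_≡_)

-- The sequence R = ⟨s, r₁, r₂, …⟩ is given by  s : ℕ  and  r : ℕ → ℕ,
-- where r i is r_i for i ≥ 1 (the value r 0 is ignored: r_0 = -1 below).
module _ (s : ℕ) (r : ℕ → ℕ) where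

  rval : ℕ → ℤ
  rval zero    = -[1+ 0 ]
  rval (suc i) = + r (suc i)

  rIJ : ℕ → ℕ → ℕ
  rIJ zero    j = 0
  rIJ (suc i) j = if r (suc i) <ᵇ j then 0 else 1

  data Letter : Set where
    𝕣   : Letter
    dig : ℕ → Letter

  σ : Letter → List Letter
  σ 𝕣       = 𝕣 ∷ replicate s (dig 0)
  σ (dig j) = dig (suc j) ∷ replicate (r (suc j)) (dig 0)

  -- row k of the tree 𝒯 (labels read left to right); a node of 𝒯 is a pair
  -- (k , p) with p < length (row k), and ℓ of that node is p.
  row : ℕ → List Letter
  row zero    = 𝕣 ∷ []
  row (suc k) = concatMap σ (row k)

  -- position of the parent (in the row above) of the node at position p of
  -- the row below the row xs: the children of xs are spelled by concatMap σ xs.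
  parentPos : List Letter → ℕ → ℕ
  parentPos []       p = 0
  parentPos (x ∷ xs) p =
    if p <ᵇ length (σ x) then 0 else suc (parentPos xs (p ∸ length (σ x)))

  childStart : List Letter → ℕ → ℕ
  childStart xs q = sum (map (λ x → length (σ x)) (take q xs))

  -- a : ℤ → ℤ ; a(n) = 0 for n < 0, and a(n) = ℓ(parent(v)) where v is the
  -- node at position n of row n+1 (which exists since s ≥ 1).
  a : ℤ → ℤ
  a (+ n)    = + parentPos (row n) n
  a -[1+ n ] = + 0

  aIter : ℕ → ℤ → ℤ
  aIter zero    m = m
  aIter (suc k) m = a (aIter k m)

  DProp : ℕ → ℕ → Set
  DProp n k = aIter k (+ n) - aIter k (+ n - + 1) ≡ + 1

  -- "d(n) = k": k is the maximum of { k ≥ 0 : a^k(n) - a^k(n-1) = 1 }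
  IsD : ℕ → ℕ → Set
  IsD n k = DProp n k × (∀ k′ → DProp n k′ → k′ ≤ k)

-- Each row of 𝒯 is a prefix of the next and row m contains position m, so
-- labels, parents and left-most children can be read off positions alone. The
-- labels encode the shape of the tree: [0] marks a node that is not the
-- left-most child of its parent, and [t+1] the left-most child of a node
-- labelled [t]. Hence if m ≥ 1 is labelled [t], a maps the consecutive pair
-- (m, m-1) to a consecutive pair whose right node is labelled [t-1]; after t
-- steps the right node is labelled [0], so one more step merges the pair and
-- the difference stays 0 from then on: d(m) = t. Thus r_{d(m),i} = 1 says that
-- m is the left-most child of a node labelled [t-1], whose r_t + 1 children
-- m, …, m + r_t include m + i; that is, m is the left-most child of the parent
-- of m + i. The hypothesis n > s rules out m = 0, the left-most child of the
-- root, whose children are 0, …, s.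
module Submission where

open import Defs
open import Data.Bool using (true; false; if_then_else_)
open import Data.Bool.Properties using (T-≡)
open import Data.Empty using (⊥-elim)
open import Data.Integer as ℤ using (_-_)
open import Data.Integer.Properties using (i≡j⇒i-j≡0; [+m]-[+n]≡m⊖n; ⊖-≥)
open import Data.List using (List; []; _∷_; _++_; replicate; concatMap; length)
open import Data.List.Properties using (length-++; length-replicate; concatMap-++; ++-assoc; ++-identityʳ)
open import Data.Nat using (ℕ; zero; suc; _+_; _∸_; _≤_; _<_; _<ᵇ_; _≤′_; ≤′-refl; ≤′-step; z≤n; s≤s; _<?_)
open import Data.Nat.Properties
open import Data.Product using (∃; _×_; _,_; proj₁; proj₂)
open import Data.Sum using (_⊎_; inj₁; inj₂)
open import Function using (_∘_)
open import Function.Bundles using (_⇔_; mk⇔; Equivalence)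
open import Relation.Nullary using (¬_; yes; no; contradiction)
open import Relation.Binary.PropositionalEquality

<ᵇ-true : ∀ {m n} → m < n → (m <ᵇ n) ≡ true
<ᵇ-true = Equivalence.to T-≡ ∘ <⇒<ᵇ

<ᵇ-false : ∀ {m n} → n ≤ m → (m <ᵇ n) ≡ false
<ᵇ-false {m}     {zero}  _         = refl
<ᵇ-false {suc m} {suc n} (s≤s n≤m) = <ᵇ-false n≤m

<⊎+ : ∀ m n → n < m ⊎ ∃ λ o → m + o ≡ n
<⊎+ m n with n <? m
... | yes n<m = inj₁ n<m
... | no  n≮m = inj₂ (m≤n⇒∃[o]m+o≡n (≮⇒≥ n≮m))

module _ {A : Set} (default : A) where

  at : List A → ℕ → A
  at []       _       = default
  at (x ∷ xs) zero    = x
  at (x ∷ xs) (suc j) = at xs j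

  at-++ˡ : ∀ xs ys {j} → j < length xs → at (xs ++ ys) j ≡ at xs j
  at-++ˡ (x ∷ xs) ys {zero}  _         = refl
  at-++ˡ (x ∷ xs) ys {suc j} (s≤s j<) = at-++ˡ xs ys j<

  at-++ʳ : ∀ xs ys j → at (xs ++ ys) (length xs + j) ≡ at ys j
  at-++ʳ []       ys j = refl
  at-++ʳ (x ∷ xs) ys j = at-++ʳ xs ys j

  at-replicate : ∀ n j → at (replicate n default) j ≡ default
  at-replicate zero    j       = refl
  at-replicate (suc n) zero    = refl
  at-replicate (suc n) (suc j) = at-replicate n j

module Blocks (s : ℕ) (r : ℕ → ℕ) where

  Label : Set
  Label = Letter s r

  σ* : List Label → List Label
  σ* = concatMap (σ s r)

  deg : Label → ℕ
  deg x = length (σ s r x)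

  -- Out of range this lookup returns [0]; σ-tail relies on it.
  _!_ : List Label → ℕ → Label
  _!_ = at (dig 0)

  parentIn : List Label → ℕ → ℕ
  parentIn = parentPos s r

  firstChildIn : List Label → ℕ → ℕ
  firstChildIn = childStart s r

  record InBlock (c : ℕ) (x : Label) (p : ℕ) : Set where
    constructor inBlock
    field
      start≤ : c ≤ p
      <end   : p < c + deg x

  open InBlock public

  deg-𝕣 : deg 𝕣 ≡ suc s
  deg-𝕣 = cong suc (length-replicate s)

  deg-dig : ∀ j → deg (dig j) ≡ suc (r (suc j))
  deg-dig j = cong suc (length-replicate (r (suc j)))

  deg-pos : ∀ x → 0 < deg x
  deg-pos 𝕣       = s≤s z≤n
  deg-pos (dig _) = s≤s z≤n

  dig≢𝕣 : ∀ {j} → dig {s} {r} j ≢ 𝕣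
  dig≢𝕣 ()

  dig-injective : ∀ {i j} → dig {s} {r} i ≡ dig j → i ≡ j
  dig-injective refl = refl

  σ-tail : ∀ x j → σ s r x ! suc j ≡ dig 0
  σ-tail 𝕣       = at-replicate (dig 0) s
  σ-tail (dig i) = at-replicate (dig 0) (r (suc i))

  σ-!≡𝕣 : ∀ x j → σ s r x ! j ≡ 𝕣 → j ≡ 0 × x ≡ 𝕣
  σ-!≡𝕣 𝕣       zero    _ = refl , refl
  σ-!≡𝕣 (dig _) zero    ()
  σ-!≡𝕣 x       (suc j) e = ⊥-elim (dig≢𝕣 (trans (sym (σ-tail x j)) e))

  σ-!≡dig-suc : ∀ x j {u} → σ s r x ! j ≡ dig (suc u) → j ≡ 0 × x ≡ dig u
  σ-!≡dig-suc 𝕣       zero    ()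
  σ-!≡dig-suc (dig _) zero    refl = refl , refl
  σ-!≡dig-suc x       (suc j) e    = ⊥-elim (0≢1+n (dig-injective (trans (sym (σ-tail x j)) e)))

  σ-!≡dig-zero : ∀ x j → σ s r x ! j ≡ dig 0 → j ≢ 0
  σ-!≡dig-zero 𝕣       zero    () _
  σ-!≡dig-zero (dig _) zero    () _
  σ-!≡dig-zero x       (suc j) _  ()

  length-σ*-∷ : ∀ x xs → length (σ* (x ∷ xs)) ≡ deg x + length (σ* xs)
  length-σ*-∷ x xs = length-++ (σ s r x)

  length-σ* : ∀ xs → length xs ≤ length (σ* xs)
  length-σ* []       = z≤n
  length-σ* (x ∷ xs) =
    subst (suc (length xs) ≤_) (sym (length-σ*-∷ x xs)) (+-mono-≤ (deg-pos x) (length-σ* xs))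

  parentIn-head : ∀ x xs {p} → p < deg x → parentIn (x ∷ xs) p ≡ 0
  parentIn-head x xs {p} p< =
    cong (λ b → if b then 0 else suc (parentIn xs (p ∸ deg x))) (<ᵇ-true p<)

  parentIn-tail : ∀ x xs p → parentIn (x ∷ xs) (deg x + p) ≡ suc (parentIn xs p)
  parentIn-tail x xs p =
    trans (cong (λ b → if b then 0 else suc (parentIn xs (deg x + p ∸ deg x)))
                (<ᵇ-false (m≤m+n (deg x) p)))
          (cong (suc ∘ parentIn xs) (m+n∸m≡n (deg x) p))

  σ*-∷-bound : ∀ x xs {p} → deg x + p < length (σ* (x ∷ xs)) → p < length (σ* xs)
  σ*-∷-bound x xs {p} h = +-cancelˡ-< (deg x) p _ (subst (deg x + p <_) (length-σ*-∷ x xs) h)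

  InBlock-∷ : ∀ {c x p} y → InBlock c x p → InBlock (deg y + c) x (deg y + p)
  InBlock-∷ {c} {x} {p} y (inBlock c≤p p<) =
    inBlock (+-monoʳ-≤ (deg y) c≤p) (subst (deg y + p <_) (sym (+-assoc (deg y) c (deg x))) (+-monoʳ-< (deg y) p<))

  InBlock-∷⁻ : ∀ {c x p} y → InBlock (deg y + c) x (deg y + p) → InBlock c x p
  InBlock-∷⁻ {c} {x} {p} y (inBlock c≤p p<) =
    inBlock (+-cancelˡ-≤ (deg y) c p c≤p)
            (+-cancelˡ-< (deg y) p _ (subst (deg y + p <_) (+-assoc (deg y) c (deg x)) p<))

  parentIn-child : ∀ xs {p} → p < length (σ* xs) →
                   parentIn xs p < length xs × InBlock (firstChildIn xs (parentIn xs p)) (xs ! parentIn xs p) p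
  parentIn-child (x ∷ xs) {p} h with <⊎+ (deg x) p
  ... | inj₁ p<deg rewrite parentIn-head x xs p<deg = s≤s z≤n , inBlock z≤n p<deg
  ... | inj₂ (p′ , refl) rewrite parentIn-tail x xs p′ =
    let q< , block = parentIn-child xs (σ*-∷-bound x xs h) in s≤s q< , InBlock-∷ x block

  parentIn-unique : ∀ xs {p q} → q < length xs → InBlock (firstChildIn xs q) (xs ! q) p → parentIn xs p ≡ q
  parentIn-unique (x ∷ xs) {q = zero}  _        (inBlock _ p<deg) = parentIn-head x xs p<deg
  parentIn-unique (x ∷ xs) {p} {suc q} (s≤s q<) block@(inBlock c≤p _) with <⊎+ (deg x) p
  ... | inj₁ p<deg       = contradiction (≤-trans (m≤m+n (deg x) _) c≤p) (<⇒≱ p<deg)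
  ... | inj₂ (p′ , refl) = trans (parentIn-tail x xs p′) (cong suc (parentIn-unique xs q< (InBlock-∷⁻ x block)))

  firstChildIn-suc : ∀ xs {q} → q < length xs → firstChildIn xs (suc q) ≡ firstChildIn xs q + deg (xs ! q)
  firstChildIn-suc (x ∷ xs) {zero}  _        = +-identityʳ (deg x)
  firstChildIn-suc (x ∷ xs) {suc q} (s≤s q<) =
    trans (cong (deg x +_) (firstChildIn-suc xs q<)) (sym (+-assoc (deg x) _ _))

  firstChildIn-++ : ∀ xs ys {q} → q ≤ length xs → firstChildIn (xs ++ ys) q ≡ firstChildIn xs q
  firstChildIn-++ xs       ys {zero}  _        = refl
  firstChildIn-++ (x ∷ xs) ys {suc q} (s≤s q≤) = cong (deg x +_) (firstChildIn-++ xs ys q≤)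

  parentIn-++ : ∀ xs ys {p} → p < length (σ* xs) → parentIn (xs ++ ys) p ≡ parentIn xs p
  parentIn-++ (x ∷ xs) ys {p} h with <⊎+ (deg x) p
  ... | inj₁ p<deg       = trans (parentIn-head x (xs ++ ys) p<deg) (sym (parentIn-head x xs p<deg))
  ... | inj₂ (p′ , refl) =
    trans (parentIn-tail x (xs ++ ys) p′)
          (trans (cong suc (parentIn-++ xs ys (σ*-∷-bound x xs h))) (sym (parentIn-tail x xs p′)))

  σ*-!-offset : ∀ xs {q j} → q < length xs → j < deg (xs ! q) →
                σ* xs ! (firstChildIn xs q + j) ≡ σ s r (xs ! q) ! j
  σ*-!-offset (x ∷ xs) {zero}  _        j< = at-++ˡ (dig 0) (σ s r x) (σ* xs) j<
  σ*-!-offset (x ∷ xs) {suc q} {j} (s≤s q<) j< =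
    trans (cong (σ* (x ∷ xs) !_) (+-assoc (deg x) (firstChildIn xs q) j))
          (trans (at-++ʳ (dig 0) (σ s r x) (σ* xs) _) (σ*-!-offset xs q< j<))

  σ*-! : ∀ xs {p q} → q < length xs → InBlock (firstChildIn xs q) (xs ! q) p →
         σ* xs ! p ≡ σ s r (xs ! q) ! (p ∸ firstChildIn xs q)
  σ*-! xs {p} {q} q< (inBlock c≤p p<) =
    trans (cong (σ* xs !_) (sym (m+[n∸m]≡n c≤p)))
          (σ*-!-offset xs q< (+-cancelˡ-< c _ _ (subst (_< c + _) (sym (m+[n∸m]≡n c≤p)) p<)))
    where c = firstChildIn xs q

module Tree (s : ℕ) (r : ℕ → ℕ) (1≤s : 1 ≤ s) where

  open Blocks s r

  Row : ℕ → List Label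
  Row = row s r

  row-suc-prefix : ∀ j → ∃ λ T → Row (suc j) ≡ Row j ++ T
  row-suc-prefix zero    = _ , refl
  row-suc-prefix (suc j) =
    let T , e = row-suc-prefix j in σ* T , trans (cong σ* e) (concatMap-++ (σ s r) (Row j) T)

  row-prefix : ∀ {j k} → j ≤ k → ∃ λ T → Row k ≡ Row j ++ T
  row-prefix = prefix ∘ ≤⇒≤′
    where
    prefix : ∀ {j k} → j ≤′ k → ∃ λ T → Row k ≡ Row j ++ T
    prefix ≤′-refl            = [] , sym (++-identityʳ _)
    prefix (≤′-step {k} j≤′k) =
      let T , e = prefix j≤′k ; U , e′ = row-suc-prefix k
      in T ++ U , trans e′ (trans (cong (_++ U) e) (++-assoc _ T U))

  row-head : ∀ j → ∃ λ T → Row j ≡ 𝕣 ∷ T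
  row-head zero    = [] , refl
  row-head (suc j) = let T , e = row-head j in _ , cong σ* e

  length-row-suc : ∀ j → length (Row j) < length (Row (suc j))
  length-row-suc j = let T , e = row-head j in subst (λ xs → length xs < length (σ* xs)) (sym e) (grows T)
    where
    grows : ∀ T → length (𝕣 ∷ T) < length (σ* (𝕣 ∷ T))
    grows T = s≤s (subst (suc (length T) ≤_)
                         (sym (trans (length-++ (replicate s (dig 0))) (cong (_+ length (σ* T)) (length-replicate s))))
                         (+-mono-≤ 1≤s (length-σ* T)))

  length-row : ∀ j → j < length (Row j)
  length-row zero    = s≤s z≤n
  length-row (suc j) = ≤-trans (s≤s (length-row j)) (length-row-suc j)

  at-row : ∀ {j k m} → j ≤ k → m < length (Row j) → Row k ! m ≡ Row j ! m
  at-row {j} {m = m} j≤k m< = let T , e = row-prefix j≤k in trans (cong (_! m) e) (at-++ˡ (dig 0) (Row j) T m<)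

  parentIn-row : ∀ {j k p} → j ≤ k → p < length (Row (suc j)) → parentIn (Row k) p ≡ parentIn (Row j) p
  parentIn-row {j} {p = p} j≤k p< =
    let T , e = row-prefix j≤k in trans (cong (λ xs → parentIn xs p) e) (parentIn-++ (Row j) T p<)

  firstChildIn-row : ∀ {j k q} → j ≤ k → q ≤ length (Row j) → firstChildIn (Row k) q ≡ firstChildIn (Row j) q
  firstChildIn-row {j} {q = q} j≤k q≤ =
    let T , e = row-prefix j≤k in trans (cong (λ xs → firstChildIn xs q) e) (firstChildIn-++ (Row j) T q≤)

  label : ℕ → Label
  label m = Row m ! m

  parent : ℕ → ℕ
  parent m = parentIn (Row m) m

  firstChild : ℕ → ℕ
  firstChild q = firstChildIn (Row q) q

  label-row : ∀ j {m} → m < length (Row j) → Row j ! m ≡ label m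
  label-row j {m} m< with ≤-total j m
  ... | inj₁ j≤m = sym (at-row j≤m m<)
  ... | inj₂ m≤j = at-row m≤j (length-row m)

  parent-row : ∀ j {p} → p < length (Row (suc j)) → parentIn (Row j) p ≡ parent p
  parent-row j {p} p< with ≤-total j p
  ... | inj₁ j≤p = sym (parentIn-row j≤p p<)
  ... | inj₂ p≤j = parentIn-row p≤j (<⇒≤ (length-row (suc p)))

  firstChild-row : ∀ j {q} → q < length (Row j) → firstChildIn (Row j) q ≡ firstChild q
  firstChild-row j {q} q< with ≤-total j q
  ... | inj₁ j≤q = sym (firstChildIn-row j≤q (<⇒≤ q<))
  ... | inj₂ q≤j = firstChildIn-row q≤j (<⇒≤ (length-row q))

  InBlock-row : ∀ j {q p} → q < length (Row j) →
                InBlock (firstChildIn (Row j) q) (Row j ! q) p → InBlock (firstChild q) (label q) p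
  InBlock-row j {p = p} q< = subst₂ (λ c x → InBlock c x p) (firstChild-row j q<) (label-row j q<)

  in-next-row : ∀ m → m < length (Row (suc m))
  in-next-row m = <⇒≤ (length-row (suc m))

  parent-child : ∀ m → InBlock (firstChild (parent m)) (label (parent m)) m
  parent-child m = let q< , block = parentIn-child (Row m) (in-next-row m) in InBlock-row m q< block

  parent-unique : ∀ {m} q → InBlock (firstChild q) (label q) m → parent m ≡ q
  parent-unique {m} q block =
    trans (sym (parent-row M m<)) (parentIn-unique (Row M) q< (InBlock-row⁻ block))
    where
    M = m + q
    q< : q < length (Row M)
    q< = ≤-<-trans (m≤n+m q m) (length-row M)
    m< : m < length (Row (suc M))
    m< = ≤-<-trans (≤-trans (m≤m+n m q) (n≤1+n M)) (length-row (suc M))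
    InBlock-row⁻ : InBlock (firstChild q) (label q) m → InBlock (firstChildIn (Row M) q) (Row M ! q) m
    InBlock-row⁻ = subst₂ (λ c x → InBlock c x m) (sym (firstChild-row M q<)) (sym (label-row M q<))

  siblingIndex : ℕ → ℕ
  siblingIndex m = m ∸ firstChild (parent m)

  label-parent : ∀ m → label m ≡ σ s r (label (parent m)) ! siblingIndex m
  label-parent m =
    let q< , block = parentIn-child (Row m) (in-next-row m)
    in trans (sym (label-row (suc m) (in-next-row m)))
             (trans (σ*-! (Row m) q< block)
                    (cong₂ (λ x c → σ s r x ! (m ∸ c)) (label-row m q<) (firstChild-row m q<)))

  firstChild-suc : ∀ q → firstChild (suc q) ≡ firstChild q + deg (label q)
  firstChild-suc q =
    let q< = <⇒≤ (length-row (suc q))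
    in trans (firstChildIn-suc (Row (suc q)) q<)
             (cong₂ (λ c x → c + deg x) (firstChild-row (suc q) q<) (label-row (suc q) q<))

  row-!≡𝕣 : ∀ j {m} → m < length (Row j) → Row j ! m ≡ 𝕣 → m ≡ 0
  row-!≡𝕣 zero    {zero}  _ _ = refl
  row-!≡𝕣 zero    {suc m} (s≤s ()) _
  row-!≡𝕣 (suc j) {m}     m< e =
    let q< , block = parentIn-child (Row j) m<
        offset≡0 , parent𝕣 = σ-!≡𝕣 (Row j ! q) (m ∸ firstChildIn (Row j) q) (trans (sym (σ*-! (Row j) q< block)) e)
    in n≤0⇒n≡0 (subst (λ q → m ≤ firstChildIn (Row j) q) (row-!≡𝕣 j q< parent𝕣) (m∸n≡0⇒m≤n offset≡0))
    where q = parentIn (Row j) m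

  label≡𝕣 : ∀ m → label m ≡ 𝕣 → m ≡ 0
  label≡𝕣 m = row-!≡𝕣 m (length-row m)

  label-suc : ∀ x → ∃ λ t → label (suc x) ≡ dig t
  label-suc x with label (suc x) in e
  ... | 𝕣     = contradiction (label≡𝕣 (suc x) e) λ ()
  ... | dig t = t , refl

  leftmost : ∀ m {u} → label m ≡ dig (suc u) → firstChild (parent m) ≡ m × label (parent m) ≡ dig u
  leftmost m e =
    let offset≡0 , parent-label = σ-!≡dig-suc (label (parent m)) (siblingIndex m) (trans (sym (label-parent m)) e)
    in ≤-antisym (start≤ (parent-child m)) (m∸n≡0⇒m≤n offset≡0) , parent-label

  non-leftmost : ∀ m → label m ≡ dig 0 → firstChild (parent m) < m
  non-leftmost m e = m∸n≢0⇒n<m (σ-!≡dig-zero (label (parent m)) (siblingIndex m) (trans (sym (label-parent m)) e))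

  parent-pred-inner : ∀ y → label (suc y) ≡ dig 0 → parent y ≡ parent (suc y)
  parent-pred-inner y e =
    parent-unique (parent (suc y))
                  (inBlock (≤-pred (non-leftmost (suc y) e)) (<-trans (n<1+n y) (<end (parent-child (suc y)))))

  parent-pred-leftmost : ∀ y {u} → label (suc y) ≡ dig (suc u) →
                         ∃ λ w → parent (suc y) ≡ suc w × parent y ≡ w × label (suc w) ≡ dig u
  parent-pred-leftmost y e = let fc≡ , lq = leftmost (suc y) e in go (parent (suc y)) refl fc≡ lq
    where
    go : ∀ {u} q → parent (suc y) ≡ q → firstChild q ≡ suc y → label q ≡ dig u →
         ∃ λ w → parent (suc y) ≡ suc w × parent y ≡ w × label (suc w) ≡ dig u
    go zero    _  _  ()
    go (suc w) pq fc lq =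
      let ends = trans (sym (firstChild-suc w)) fc
      in w , pq ,
         parent-unique w (inBlock (≤-pred (subst (firstChild w <_) ends (m<m+n (firstChild w) (deg-pos (label w)))))
                                  (subst (y <_) (sym ends) (n<1+n y))) ,
         lq

  leftmost-parent : ∀ {m} i → m ≡ firstChild (parent (m + i)) → parent m ≡ parent (m + i)
  leftmost-parent {m} i h =
    parent-unique (parent (m + i))
                  (inBlock (≤-reflexive (sym h)) (≤-<-trans (m≤m+n m i) (<end (parent-child (m + i)))))

  rIJ-suc≡1⇔ : ∀ u i → rIJ s r (suc u) i ≡ 1 ⇔ i ≤ r (suc u)
  rIJ-suc≡1⇔ u i with r (suc u) <? i
  ... | yes r<i rewrite <ᵇ-true r<i           = mk⇔ (λ ()) (λ i≤r → contradiction i≤r (<⇒≱ r<i))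
  ... | no  r≮i rewrite <ᵇ-false (≮⇒≥ r≮i) = mk⇔ (λ _ → ≮⇒≥ r≮i) (λ _ → refl)

  rIJ≡1⇔leftmost : ∀ m {t} i → label m ≡ dig t → rIJ s r t i ≡ 1 ⇔ m ≡ firstChild (parent (m + i))
  rIJ≡1⇔leftmost m {zero} i e =
    mk⇔ (λ ())
        (λ h → contradiction (trans (cong firstChild (leftmost-parent i h)) (sym h)) (<⇒≢ (non-leftmost m e)))
  rIJ≡1⇔leftmost m {suc u} i e = mk⇔ to from
    where
    fc≡m = proj₁ (leftmost m e)
    block-end : firstChild (parent m) + deg (label (parent m)) ≡ m + suc (r (suc u))
    block-end = cong₂ _+_ fc≡m (trans (cong deg (proj₂ (leftmost m e))) (deg-dig u))

    to : rIJ s r (suc u) i ≡ 1 → m ≡ firstChild (parent (m + i))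
    to h =
      let i≤r = Equivalence.to (rIJ-suc≡1⇔ u i) h
          same = parent-unique (parent m)
                               (inBlock (≤-trans (≤-reflexive fc≡m) (m≤m+n m i))
                                        (subst (m + i <_) (sym block-end) (+-monoʳ-< m (s≤s i≤r))))
      in trans (sym fc≡m) (cong firstChild (sym same))

    from : m ≡ firstChild (parent (m + i)) → rIJ s r (suc u) i ≡ 1
    from h =
      let m+i< = subst (λ q → m + i < firstChild q + deg (label q))
                       (sym (leftmost-parent i h)) (<end (parent-child (m + i)))
      in Equivalence.from (rIJ-suc≡1⇔ u i) (≤-pred (+-cancelˡ-< m i _ (subst (m + i <_) block-end m+i<)))

  aIter-+-agree : ∀ e {k m m′} → aIter s r k m ≡ aIter s r k m′ → aIter s r (e + k) m ≡ aIter s r (e + k) m′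
  aIter-+-agree zero    h = h
  aIter-+-agree (suc e) h = cong (a s r) (aIter-+-agree e h)

  IsD-last : ∀ {n t dn} → DProp s r n t → aIter s r (suc t) (ℤ.+ n) ≡ aIter s r (suc t) (ℤ.+ n - ℤ.+ 1) →
             IsD s r n dn → dn ≡ t
  IsD-last {n} {t} {dn} holds settles (holds-dn , maximal) =
    ≤-antisym (≮⇒≥ λ t<dn → fails (subst (DProp s r n) (sym (m∸n+n≡m t<dn)) holds-dn)) (maximal t holds)
    where
    fails : ¬ DProp s r n ((dn ∸ suc t) + suc t)
    fails dp with trans (sym (i≡j⇒i-j≡0 (aIter-+-agree (dn ∸ suc t) settles))) dp
    ... | ()

  iterate-leftmost : ∀ k x {u} → label (suc x) ≡ dig (k + u) →
                     ∃ λ y → aIter s r k (ℤ.+ suc x) ≡ ℤ.+ suc y × aIter s r k (ℤ.+ x) ≡ ℤ.+ y × label (suc y) ≡ dig u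
  iterate-leftmost zero    x e = _ , refl , refl , e
  iterate-leftmost (suc k) x {u} e =
    let y , e₁ , e₀ , ly = iterate-leftmost k x (trans e (cong dig (sym (+-suc k u))))
        w , p₁ , p₀ , lw = parent-pred-leftmost y ly
    in w , trans (cong (a s r) e₁) (cong ℤ.+_ p₁) , trans (cong (a s r) e₀) (cong ℤ.+_ p₀) , lw

  d-zero : ∀ {dn} → IsD s r 0 dn → dn ≡ 0
  d-zero = IsD-last refl refl

  d-label : ∀ x {t dn} → label (suc x) ≡ dig t → IsD s r (suc x) dn → dn ≡ t
  d-label x {t} e =
    let y , e₁ , e₀ , ly = iterate-leftmost t x (trans e (cong dig (sym (+-identityʳ t))))
    in IsD-last (trans (cong₂ _-_ e₁ e₀) (consecutive y))
                (trans (cong (a s r) e₁) (trans (cong ℤ.+_ (sym (parent-pred-inner y ly))) (sym (cong (a s r) e₀))))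
    where
    consecutive : ∀ y → ℤ.+ suc y - ℤ.+ y ≡ ℤ.+ 1
    consecutive y = trans ([+m]-[+n]≡m⊖n (suc y) y) (trans (⊖-≥ (n≤1+n y)) (cong ℤ.+_ (m+n∸n≡m 1 y)))

  rIJ-d⇔leftmost : ∀ {m n i dn} → s < n → m + i ≡ n → IsD s r m dn →
                   rIJ s r dn i ≡ 1 ⇔ m ≡ firstChild (parent n)
  rIJ-d⇔leftmost {zero} {n} s<n _ isD rewrite d-zero isD =
    mk⇔ (λ ()) (λ h → contradiction (root-child (firstChild≡0 (sym h))) (<⇒≱ s<n))
    where
    firstChild≡0 : ∀ {q} → firstChild q ≡ 0 → q ≡ 0
    firstChild≡0 {zero}  _ = refl
    firstChild≡0 {suc w} h =
      contradiction (m+n≡0⇒n≡0 (firstChild w) (trans (sym (firstChild-suc w)) h)) (n>0⇒n≢0 (deg-pos (label w)))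
    root-child : parent n ≡ 0 → n ≤ s
    root-child p≡0 =
      ≤-pred (subst (n <_) deg-𝕣 (subst (λ q → n < firstChild q + deg (label q)) p≡0 (<end (parent-child n))))
  rIJ-d⇔leftmost {suc x} s<n refl isD =
    let t , e = label-suc x in subst (λ d → rIJ s r d _ ≡ 1 ⇔ _) (sym (d-label x e isD)) (rIJ≡1⇔leftmost (suc x) _ e)

lemma9 : (s : ℕ) (r : ℕ → ℕ) → 1 ≤ s →
         (n i k : ℕ) → s < n → i ≤ n →
         n < length (row s r (suc k)) →
         (dn : ℕ) → IsD s r (n ∸ i) dn →
         (rIJ s r dn i ≡ 1)
           ⇔ (n ∸ i ≡ childStart s r (row s r k) (parentPos s r (row s r k) n))
lemma9 s r 1≤s n i k s<n i≤n n< dn isD =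
  subst (λ c → rIJ s r dn i ≡ 1 ⇔ n ∸ i ≡ c) (sym parent-block)
        (rIJ-d⇔leftmost s<n (m∸n+n≡m i≤n) isD)
  where
  open Blocks s r
  open Tree s r 1≤s
  parent-block : childStart s r (row s r k) (parentPos s r (row s r k) n) ≡ firstChild (parent n)
  parent-block = trans (firstChild-row k (proj₁ (parentIn-child (row s r k) n<))) (cong firstChild (parent-row k n<))
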